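{- Let $\mathbb{T}$ be a graded theory and $n\le\omega$. The forgetful functor from the category of $(\mathbb{T},n)$-models (and homomorphisms of $(\Sigma,n)$-algebras) to $\mathsf{Pos}$, mapping $(A_k)_{k\le n}$ to $A_0$, has a left adjoint, which assigns to a poset $X$ the free $(\mathbb{T},n)$-model on $X$.
   Context: $\mathsf{Pos}$: posets and monotone maps; $\mathsf{Pos}(P,A)$ monotone maps ordered pointwise. Graded signature $\Sigma$: sets $\Sigma(P,n)$ of operation symbols for finite posets $P$ and $n\in\omega$; $\mathrm{ar}(\sigma)=P$, $d(\sigma)=n$. Terms over a poset $\Gamma$ of uniform depth: variables have depth $0$; $\sigma(f)$ has depth $d(\sigma)+m$ for any function $f\colon|\mathrm{ar}(\sigma)|\to$ terms of depth $m$. A $(\Sigma,n)$-algebra $A$ ($n\le\omega$): posets $A_k$ ($k\le n$) and monotone $\sigma^A_k\colon\mathsf{Pos}(\mathrm{ar}(\sigma),A_k)\to A_{d(\sigma)+k}$ for $d(\sigma)+k\le n$; homomorphisms: families of monotone $h_k$ with $h_{k+d(\sigma)}\cdot\sigma^A_k=\sigma^B_k\cdot\mathsf{Pos}(\mathrm{ar}(\sigma),h_k)$. Evaluation of a term under monotone $\iota\colon\Gamma\to A_m$ is partial: $\iota^\#_0(x)=\iota(x)$; $\iota^\#(\sigma(f))$ is defined iff all $\iota^\#(f(i))$ are defined and $i\le j$ in $\mathrm{ar}(\sigma)$ implies $\iota^\#(f(i))\le\iota^\#(f(j))$, and then equals $\sigma^A(\iota^\#\cdot f)$. A graded theory $\mathbb{T}=(\Sigma,\mathcal{E})$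 consists of a set $\mathcal{E}$ of inequations $\Gamma\vdash_k s\le t$ between depth-$k$ terms over a poset $\Gamma$; a $(\mathbb{T},n)$-model is a $(\Sigma,n)$-algebra such that for every axiom and every monotone $\iota\colon\Gamma\to A_m$ with $m+k\le n$ both sides are defined and $\iota^\#_k(s)\le\iota^\#_k(t)$. A free $(\mathbb{T},n)$-model on $X$ is a model $FX$ with monotone $\eta_X\colon X\to(FX)_0$ such that every monotone $h\colon X\to A_0$ into a model extends uniquely to a homomorphism $h^\sharp$ with $h^\sharp_0\cdot\eta_X=h$. -}

module Defs where

open import Level using (0ℓ)
open import Data.Nat using (ℕ; zero; suc; _+_; _≤_; z≤n)
open import Data.Nat.Properties using (m≤n+m; m≤m+n; ≤-trans; +-assoc; ≤-reflexive)
open import Data.Fin using (Fin)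
open import Data.Unit using (⊤; tt)
open import Data.Product using (Σ; _×_; _,_; proj₁; proj₂)
open import Relation.Binary.PropositionalEquality using (_≡_; refl; sym)
open import Relation.Binary.Bundles using (Poset)
open import Relation.Binary.Structures using (IsPartialOrder)

data ℕ∞ : Set where
  fin : ℕ → ℕ∞
  ω   : ℕ∞

infix 4 _≤∞_
_≤∞_ : ℕ → ℕ∞ → Set
k ≤∞ fin n = k ≤ n
k ≤∞ ω     = ⊤

≤∞-trans : ∀ {i j} (n : ℕ∞) → i ≤ j → j ≤∞ n → i ≤∞ n
≤∞-trans (fin n) i≤j j≤n = ≤-trans i≤j j≤n
≤∞-trans ω       _   _   = tt

drop-d : ∀ {n : ℕ∞} (d k : ℕ) → d + k ≤∞ n → k ≤∞ n
drop-d {n} d k p = ≤∞-trans n (m≤n+m k d) p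

drop-k : ∀ {n : ℕ∞} (k m : ℕ) → k + m ≤∞ n → m ≤∞ n
drop-k {n} k m p = ≤∞-trans n (m≤n+m m k) p

zero≤∞ : (n : ℕ∞) → 0 ≤∞ n
zero≤∞ (fin n) = z≤n
zero≤∞ ω       = tt

Pos : Set₁
Pos = Poset 0ℓ 0ℓ 0ℓ

record Monotone (P Q : Pos) : Set where
  field
    fun  : Poset.Carrier P → Poset.Carrier Q
    mono : ∀ {x y} → Poset._≤_ P x y → Poset._≤_ Q (fun x) (fun y)
open Monotone public

record FinPoset : Set₁ where
  field
    size : ℕ
    _⊑_  : Fin size → Fin size → Set
    isPartialOrder : IsPartialOrder _≡_ _⊑_
open FinPoset public

IsMonotoneFrom : (P : FinPoset) (A : Pos) → (Fin (size P) → Poset.Carrier A) → Set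
IsMonotoneFrom P A f = ∀ {i j} → _⊑_ P i j → Poset._≤_ A (f i) (f j)

-- Graded signatures: Σ(P,d) presented as a set of operation symbols
-- together with arity ar(σ) (a finite poset) and depth d(σ).

record Signature : Set₁ where
  field
    Op  : Set
    ar  : Op → FinPoset
    dep : Op → ℕ
open Signature public

module _ (S : Signature) where

  data Term (V : Set) : ℕ → Set where
    var : V → Term V 0
    op  : (σ : Op S) {m : ℕ} → (Fin (size (ar S σ)) → Term V m) → Term V (dep S σ + m)

  record Algebra (n : ℕ∞) : Set₁ where
    field
      A   : (k : ℕ) → .(k ≤∞ n) → Pos
      opA : (σ : Op S) (k : ℕ) .(p : dep S σ + k ≤∞ n)
            (f : Fin (size (ar S σ)) → Poset.Carrier (A k (drop-d (dep S σ) k p))) →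
            IsMonotoneFrom (ar S σ) (A k (drop-d (dep S σ) k p)) f →
            Poset.Carrier (A (dep S σ + k) p)
      opA-mono : (σ : Op S) (k : ℕ) .(p : dep S σ + k ≤∞ n)
            (f g : Fin (size (ar S σ)) → Poset.Carrier (A k (drop-d (dep S σ) k p)))
            (mf : IsMonotoneFrom (ar S σ) (A k (drop-d (dep S σ) k p)) f)
            (mg : IsMonotoneFrom (ar S σ) (A k (drop-d (dep S σ) k p)) g) →
            (∀ i → Poset._≤_ (A k (drop-d (dep S σ) k p)) (f i) (g i)) →
            Poset._≤_ (A (dep S σ + k) p) (opA σ k p f mf) (opA σ k p g mg)
  open Algebra public

  record Hom {n : ℕ∞} (𝔸 𝔹 : Algebra n) : Set where
    field
      hom  : (k : ℕ) .(p : k ≤∞ n) → Poset.Carrier (A 𝔸 k p) → Poset.Carrier (A 𝔹 k p)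
      hom-mono : (k : ℕ) .(p : k ≤∞ n) {x y : Poset.Carrier (A 𝔸 k p)} →
                 Poset._≤_ (A 𝔸 k p) x y → Poset._≤_ (A 𝔹 k p) (hom k p x) (hom k p y)
      hom-op : (σ : Op S) (k : ℕ) .(p : dep S σ + k ≤∞ n)
               (f : Fin (size (ar S σ)) → Poset.Carrier (A 𝔸 k (drop-d (dep S σ) k p)))
               (mf : IsMonotoneFrom (ar S σ) (A 𝔸 k (drop-d (dep S σ) k p)) f) →
               Poset._≈_ (A 𝔹 (dep S σ + k) p)
                 (hom (dep S σ + k) p (opA 𝔸 σ k p f mf))
                 (opA 𝔹 σ k p (λ i → hom k (drop-d (dep S σ) k p) (f i))
                              (λ i⊑j → hom-mono k (drop-d (dep S σ) k p) (mf i⊑j)))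
  open Hom public

  module Eval {n : ℕ∞} (𝔸 : Algebra n) (Γ : Pos) (m : ℕ) .(q : m ≤∞ n)
              (ι : Poset.Carrier Γ → Poset.Carrier (A 𝔸 m q)) where

    cast : ∀ {i j} → i ≡ j → .(p : i ≤∞ n) .(p' : j ≤∞ n) →
           Poset.Carrier (A 𝔸 i p) → Poset.Carrier (A 𝔸 j p')
    cast refl p p' x = x

    sub : ∀ σ k → (dep S σ + k) + m ≤∞ n → k + m ≤∞ n
    sub σ k p = drop-d (dep S σ) (k + m) (≤∞-trans n (≤-reflexive (sym (+-assoc (dep S σ) k m))) p)

    reassoc : ∀ σ k → (dep S σ + k) + m ≤∞ n → dep S σ + (k + m) ≤∞ n
    reassoc σ k p = ≤∞-trans n (≤-reflexive (sym (+-assoc (dep S σ) k m))) p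

    mutual
      Defined : ∀ {k} → Term (Poset.Carrier Γ) k → .(k + m ≤∞ n) → Set
      Defined (var x) p = ⊤
      Defined (op σ {k} f) p =
        Σ ((i : Fin (size (ar S σ))) → Defined (f i) (sub σ k p))
          (λ ds → ∀ {i j} → _⊑_ (ar S σ) i j →
             Poset._≤_ (A 𝔸 (k + m) (sub σ k p))
               (eval (f i) (sub σ k p) (ds i)) (eval (f j) (sub σ k p) (ds j)))

      eval : ∀ {k} (t : Term (Poset.Carrier Γ) k) .(p : k + m ≤∞ n) →
             Defined t p → Poset.Carrier (A 𝔸 (k + m) p)
      eval (var x) p _ = ι x
      eval (op σ {k} f) p (ds , mon) =
        cast (sym (+-assoc (dep S σ) k m)) (reassoc σ k p) p
          (opA 𝔸 σ (k + m) (reassoc σ k p) (λ i → eval (f i) (sub σ k p) (ds i)) mon)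

record Inequation (S : Signature) : Set₁ where
  field
    ctx   : Pos
    depth : ℕ
    lhs   : Term S (Poset.Carrier ctx) depth
    rhs   : Term S (Poset.Carrier ctx) depth
open Inequation public

record Theory : Set₁ where
  field
    sig : Signature
    Ax  : Set
    ax  : Ax → Inequation sig
open Theory public

module _ (T : Theory) where

  IsModel : {n : ℕ∞} → Algebra (sig T) n → Set
  IsModel {n} 𝔸 =
    (a : Ax T) (m : ℕ) (p : depth (ax T a) + m ≤∞ n)
    (ι : Monotone (ctx (ax T a)) (A 𝔸 m (drop-k (depth (ax T a)) m p))) →
    let open Eval (sig T) 𝔸 (ctx (ax T a)) m (drop-k (depth (ax T a)) m p) (fun ι) in
    Σ (Defined (lhs (ax T a)) p) λ dl →
    Σ (Defined (rhs (ax T a)) p) λ dr →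
      Poset._≤_ (A 𝔸 (depth (ax T a) + m) p) (eval (lhs (ax T a)) p dl) (eval (rhs (ax T a)) p dr)

  record Model (n : ℕ∞) : Set₁ where
    field
      alg     : Algebra (sig T) n
      isModel : IsModel alg
  open Model public

  record FreeModel (n : ℕ∞) (X : Pos) : Set₁ where
    field
      FX : Model n
      η  : Monotone X (A (alg FX) 0 (zero≤∞ n))
      extend : (𝔹 : Model n) (h : Monotone X (A (alg 𝔹) 0 (zero≤∞ n))) →
        Σ (Hom (sig T) (alg FX) (alg 𝔹)) λ h♯ →
          ((x : Poset.Carrier X) →
             Poset._≈_ (A (alg 𝔹) 0 (zero≤∞ n)) (hom h♯ 0 (zero≤∞ n) (fun η x)) (fun h x))
          ×
          ((g : Hom (sig T) (alg FX) (alg 𝔹)) →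
             ((x : Poset.Carrier X) →
                Poset._≈_ (A (alg 𝔹) 0 (zero≤∞ n)) (hom g 0 (zero≤∞ n) (fun η x)) (fun h x)) →
             (k : ℕ) (p : k ≤∞ n) (y : Poset.Carrier (A (alg FX) k p)) →
               Poset._≈_ (A (alg 𝔹) k p) (hom g k p y) (hom h♯ k p y))

-- The free model is syntactic. Its elements of depth k are the terms over X of depth k that
-- are defined, ordered by the least relation that contains the order of X, makes every
-- operation monotone, is transitive through defined terms, and validates every instance of
-- an axiom within the bound n, together with the order constraints that the two sides of
-- that instance must satisfy to be defined. Every one of these rules is sound in every
-- model, so a monotone h : X → B₀ extends, by a simultaneous induction over definedness and
-- order, to a monotone interpretation of defined terms. This is a homomorphism by
-- construction, and it is unique because every element is built from generators by
-- operations.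
module Submission where

open import Defs
open import Data.Nat using (ℕ; _+_)
open import Data.Nat.Properties using (+-assoc)
open import Data.Fin using (Fin)
open import Data.Unit using (tt)
open import Data.Product using (Σ; _×_; _,_; proj₁; proj₂; swap)
open import Relation.Binary.PropositionalEquality using (_≡_; refl; sym; subst)
open import Relation.Binary.Bundles using (Poset)
import Relation.Binary.Reasoning.PartialOrder as PosetReasoning

open Poset using (Carrier)

module _ {S : Signature} {n : ℕ∞} (𝔸 : Algebra S n) where

  opA-cong : (σ : Op S) (k : ℕ) .(p : dep S σ + k ≤∞ n)
             {f g : Fin (size (ar S σ)) → Carrier (A 𝔸 k (drop-d (dep S σ) k p))}
             (mf : IsMonotoneFrom (ar S σ) (A 𝔸 k (drop-d (dep S σ) k p)) f)
             (mg : IsMonotoneFrom (ar S σ) (A 𝔸 k (drop-d (dep S σ) k p)) g) →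
             (∀ i → Poset._≈_ (A 𝔸 k (drop-d (dep S σ) k p)) (f i) (g i)) →
             Poset._≈_ (A 𝔸 (dep S σ + k) p) (opA 𝔸 σ k p f mf) (opA 𝔸 σ k p g mg)
  opA-cong σ k p mf mg f≈g =
    Poset.antisym (A 𝔸 _ p)
      (opA-mono 𝔸 σ k p _ _ mf mg (λ i → Poset.reflexive (A 𝔸 k _) (f≈g i)))
      (opA-mono 𝔸 σ k p _ _ mg mf (λ i → Poset.reflexive (A 𝔸 k _) (Poset.Eq.sym (A 𝔸 k _) (f≈g i))))

  castA : ∀ {i j} → i ≡ j → .(p : i ≤∞ n) .(p' : j ≤∞ n) → Carrier (A 𝔸 i p) → Carrier (A 𝔸 j p')
  castA refl p p' x = x

module _ {S : Signature} {V : Set} where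

  -- The pairs (f i , f j) with i ⊑ j at the subterms op σ f of t: an evaluation of t is
  -- defined exactly when it respects the order of all of them.
  data SideCondition : ∀ {k} → Term S V k → ∀ {k'} → Term S V k' → Term S V k' → Set where
    here  : ∀ {σ k} {f : Fin (size (ar S σ)) → Term S V k} {i j} →
            _⊑_ (ar S σ) i j → SideCondition (op σ f) (f i) (f j)
    there : ∀ {σ k} {f : Fin (size (ar S σ)) → Term S V k} {i k'} {s u : Term S V k'} →
            SideCondition (f i) s u → SideCondition (op σ f) s u

  data Consequence {k} (l r : Term S V k) : ∀ {k'} → Term S V k' → Term S V k' → Set where
    inequation : Consequence l r l r
    lhs-side   : ∀ {k'} {s u : Term S V k'} → SideCondition l s u → Consequence l r s u
    rhs-side   : ∀ {k'} {s u : Term S V k'} → SideCondition r s u → Consequence l r s u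

module _ {S : Signature} {n : ℕ∞} (𝔸 : Algebra S n) (Γ : Pos) (m : ℕ) .(q : m ≤∞ n)
         (ι : Carrier Γ → Carrier (A 𝔸 m q)) where
  open Eval S 𝔸 Γ m q ι

  Holds : ∀ {k} → Term S (Carrier Γ) k → Term S (Carrier Γ) k → .(k + m ≤∞ n) → Set
  Holds {k} s u p = Σ (Defined s p) λ ds → Σ (Defined u p) λ du →
                    Poset._≤_ (A 𝔸 (k + m) p) (eval s p ds) (eval u p du)

  sideCondition-holds : ∀ {k k'} {t : Term S (Carrier Γ) k} {s u : Term S (Carrier Γ) k'} →
                        SideCondition t s u → .(pt : k + m ≤∞ n) → Defined t pt →
                        .(ps : k' + m ≤∞ n) → Holds s u ps
  sideCondition-holds (here i⊑j) pt (ds , mon) ps = ds _ , ds _ , mon i⊑j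
  sideCondition-holds (there c)   pt (ds , _)   ps = sideCondition-holds c _ (ds _) ps

  consequence-holds : ∀ {k k'} {l r : Term S (Carrier Γ) k} {s u : Term S (Carrier Γ) k'} →
                      .(pl : k + m ≤∞ n) → Holds l r pl → Consequence l r s u →
                      .(ps : k' + m ≤∞ n) → Holds s u ps
  consequence-holds pl l≤r          inequation   ps = l≤r
  consequence-holds pl (dl , _)     (lhs-side c) ps = sideCondition-holds c pl dl ps
  consequence-holds pl (_ , dr , _) (rhs-side c) ps = sideCondition-holds c pl dr ps

  cast-cong : ∀ {i j} (e : i ≡ j) .(p : i ≤∞ n) .(p' : j ≤∞ n) {x y : Carrier (A 𝔸 i p)} →
              Poset._≈_ (A 𝔸 i p) x y → Poset._≈_ (A 𝔸 j p') (cast e p p' x) (castA 𝔸 e p p' y)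
  cast-cong refl p p' x≈y = x≈y

module FreeConstruction (T : Theory) (n : ℕ∞) (X : Pos) where

  private
    S : Signature
    S = sig T

  -- The depth of op σ f e is fixed by the equation e rather than by the index, so that
  -- instantiation, which produces depth (d + k) + m, needs no transport.
  data Tm : ℕ → Set where
    var : Carrier X → Tm 0
    op  : ∀ {k j} (σ : Op S) → (Fin (size (ar S σ)) → Tm k) → dep S σ + k ≡ j → Tm j

  instantiate : ∀ {V : Set} {k m} → Term S V k → (V → Tm m) → Tm (k + m)
  instantiate (var x) ι = ι x
  instantiate {m = m} (op σ {k} f) ι =
    op σ (λ i → instantiate (f i) ι) (sym (+-assoc (dep S σ) k m))

  mutual
    data Def : ∀ {k} → Tm k → Set where
      var : ∀ {x} → Def (var x)
      op  : ∀ {σ k j} {f : Fin (size (ar S σ)) → Tm k} {e : dep S σ + k ≡ j} →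
            (∀ i → Def (f i)) → (∀ {i i'} → _⊑_ (ar S σ) i i' → f i ≼ f i') → Def (op σ f e)

    -- Transitivity only passes through defined terms, so that every derivation can be
    -- interpreted in a model.
    data _≼_ : ∀ {k} → Tm k → Tm k → Set where
      var   : ∀ {x y} → Poset._≤_ X x y → var x ≼ var y
      op    : ∀ {σ k j} {f g : Fin (size (ar S σ)) → Tm k} {e : dep S σ + k ≡ j} →
              (∀ i → f i ≼ g i) → op σ f e ≼ op σ g e
      trans : ∀ {k} {s u t : Tm k} → Def u → s ≼ u → u ≼ t → s ≼ t
      axiom : (a : Ax T) (m : ℕ) (p : depth (ax T a) + m ≤∞ n)
              (ι : Carrier (ctx (ax T a)) → Tm m) → (∀ x → Def (ι x)) →
              (∀ {x y} → Poset._≤_ (ctx (ax T a)) x y → ι x ≼ ι y) →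
              ∀ {k} {s u : Term S (Carrier (ctx (ax T a))) k} →
              Consequence (lhs (ax T a)) (rhs (ax T a)) s u → instantiate s ι ≼ instantiate u ι

  ≼-refl : ∀ {k} (t : Tm k) → t ≼ t
  ≼-refl (var x)    = var (Poset.refl X)
  ≼-refl (op σ f e) = op (λ i → ≼-refl (f i))

  _≃_ : ∀ {k} → Tm k → Tm k → Set
  s ≃ t = s ≼ t × t ≼ s

  ≼-resp-≃ : ∀ {k} {s s' u' u : Tm k} → Def s' → Def u' → s ≃ s' → s' ≼ u' → u' ≃ u → s ≼ u
  ≼-resp-≃ ds' du' (s≼s' , _) s'≼u' (u'≼u , _) = trans ds' s≼s' (trans du' s'≼u' u'≼u)

  FreePoset : ℕ → Pos
  FreePoset k = record
    { Carrier = Σ (Tm k) Def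
    ; _≈_ = λ x y → proj₁ x ≃ proj₁ y
    ; _≤_ = λ x y → proj₁ x ≼ proj₁ y
    ; isPartialOrder = record
      { isPreorder = record
        { isEquivalence = record
          { refl  = λ {x} → ≼-refl (proj₁ x) , ≼-refl (proj₁ x)
          ; sym   = λ (x≼y , y≼x) → y≼x , x≼y
          ; trans = λ {_} {y} (x≼y , y≼x) (y≼z , z≼y) →
                      trans (proj₂ y) x≼y y≼z , trans (proj₂ y) z≼y y≼x
          }
        ; reflexive = proj₁
        ; trans     = λ {_} {y} → trans (proj₂ y)
        }
      ; antisym = _,_
      }
    }

  FreeAlgebra : Algebra S n
  FreeAlgebra = record
    { A        = λ k _ → FreePoset k
    ; opA      = λ σ k p f mf → op σ (λ i → proj₁ (f i)) refl , op (λ i → proj₂ (f i)) mf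
    ; opA-mono = λ σ k p f g mf mg f≼g → op f≼g
    }

  module _ (a : Ax T) (m : ℕ) (p : depth (ax T a) + m ≤∞ n)
           (ι : Monotone (ctx (ax T a)) (FreePoset m)) where
    private
      Γ : Pos
      Γ = ctx (ax T a)

      ι₀ : Carrier Γ → Tm m
      ι₀ x = proj₁ (fun ι x)

    open Eval S FreeAlgebra Γ m (drop-k (depth (ax T a)) m p) (fun ι)

    cast-op-≃ : ∀ {σ k j} (e : dep S σ + k ≡ j) .(p₁ : dep S σ + k ≤∞ n) .(p₂ : j ≤∞ n)
                {f g : Fin (size (ar S σ)) → Tm k} (d : Def (op σ f refl)) →
                (∀ i → f i ≃ g i) → proj₁ (cast e p₁ p₂ (op σ f refl , d)) ≃ op σ g e
    cast-op-≃ refl _ _ _ f≃g = op (λ i → proj₁ (f≃g i)) , op (λ i → proj₂ (f≃g i))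

    eval≃instantiate : ∀ {k} (t : Term S (Carrier Γ) k) .(r : k + m ≤∞ n) (dt : Defined t r) →
                       proj₁ (eval t r dt) ≃ instantiate t ι₀
    eval≃instantiate (var x)      r _         = ≼-refl _ , ≼-refl _
    eval≃instantiate (op σ {k} f) r (dts , _) =
      cast-op-≃ (sym (+-assoc (dep S σ) k m)) _ r _ (λ i → eval≃instantiate (f i) _ (dts i))

    SideConditionsHold : ∀ {k} → Term S (Carrier Γ) k → Set
    SideConditionsHold t = ∀ {k'} {s u : Term S (Carrier Γ) k'} →
                           SideCondition t s u → instantiate s ι₀ ≼ instantiate u ι₀

    instantiate-Def : ∀ {k} (t : Term S (Carrier Γ) k) → SideConditionsHold t →
                      Def (instantiate t ι₀)
    instantiate-Def (var x)  _  = proj₂ (fun ι x)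
    instantiate-Def (op σ f) sc =
      op (λ i → instantiate-Def (f i) (λ c → sc (there c))) (λ i⊑j → sc (here i⊑j))

    defined : ∀ {k} (t : Term S (Carrier Γ) k) .(r : k + m ≤∞ n) → SideConditionsHold t →
              Defined t r
    defined (var x)  r _  = tt
    defined (op σ f) r sc = (λ i → defined (f i) _ (sc-at i)) , λ {i} {j} i⊑j →
      ≼-resp-≃ (instantiate-Def (f i) (sc-at i)) (instantiate-Def (f j) (sc-at j))
        (eval≃instantiate (f i) _ _) (sc (here i⊑j))
        (swap (eval≃instantiate (f j) _ _))
      where
        sc-at : ∀ i → SideConditionsHold (f i)
        sc-at i c = sc (there c)

    axiom-holds : Holds FreeAlgebra Γ m _ (fun ι) (lhs (ax T a)) (rhs (ax T a)) p
    axiom-holds =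
      defined (lhs (ax T a)) p scl , defined (rhs (ax T a)) p scr ,
      ≼-resp-≃ (instantiate-Def (lhs (ax T a)) scl) (instantiate-Def (rhs (ax T a)) scr)
        (eval≃instantiate (lhs (ax T a)) p _) (axiom-instance inequation)
        (swap (eval≃instantiate (rhs (ax T a)) p _))
      where
        axiom-instance : ∀ {k} {s u : Term S (Carrier Γ) k} →
                         Consequence (lhs (ax T a)) (rhs (ax T a)) s u →
                         instantiate s ι₀ ≼ instantiate u ι₀
        axiom-instance = axiom a m p ι₀ (λ x → proj₂ (fun ι x)) (mono ι)

        scl : SideConditionsHold (lhs (ax T a))
        scl c = axiom-instance (lhs-side c)

        scr : SideConditionsHold (rhs (ax T a))
        scr c = axiom-instance (rhs-side c)

  freeIsModel : IsModel T FreeAlgebra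
  freeIsModel = axiom-holds

  module Extension (𝔹 : Model T n) (h : Monotone X (A (alg 𝔹) 0 (zero≤∞ n))) where
    private
      B : Algebra S n
      B = alg 𝔹

    mutual
      interpret : ∀ {j} (t : Tm j) .(p : j ≤∞ n) → Def t → Carrier (A B j p)
      interpret (var x)         p var         = fun h x
      interpret (op {k} σ f e)  p (op ds mon) =
        castA B e _ p (opA B σ k (subst (_≤∞ n) (sym e) p) (λ i → interpret (f i) _ (ds i))
                        (λ i⊑i' → interpret-mono (mon i⊑i') (ds _) (ds _) _))

      interpret-irrelevant : ∀ {j} (t : Tm j) .(p : j ≤∞ n) (d d' : Def t) →
                             Poset._≈_ (A B j p) (interpret t p d) (interpret t p d')
      interpret-irrelevant (var x)       p var       var        = Poset.Eq.refl (A B 0 p)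
      interpret-irrelevant (op σ f refl) p (op ds _) (op ds' _) =
        opA-cong B σ _ p _ _ (λ i → interpret-irrelevant (f i) _ (ds i) (ds' i))

      interpret-assignment : (Γ : Pos) (m : ℕ) .(q : m ≤∞ n) (ι : Carrier Γ → Tm m)
                           (dι : ∀ x → Def (ι x)) →
                           (∀ {x y} → Poset._≤_ Γ x y → ι x ≼ ι y) → Monotone Γ (A B m q)
      interpret-assignment Γ m q ι dι mι = record
        { fun  = λ x → interpret (ι x) q (dι x)
        ; mono = λ {x} {y} x≤y → interpret-mono (mι x≤y) (dι x) (dι y) q
        }

      interpret-mono : ∀ {j} {s t : Tm j} → s ≼ t → (ds : Def s) (dt : Def t) .(p : j ≤∞ n) →
                       Poset._≤_ (A B j p) (interpret s p ds) (interpret t p dt)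
      interpret-mono (var x≤y) var var p = mono h x≤y
      interpret-mono (op {σ = σ} {e = refl} f≼g) (op df _) (op dg _) p =
        opA-mono B σ _ p _ _ _ _ (λ i → interpret-mono (f≼g i) (df i) (dg i) _)
      interpret-mono (trans du s≼u u≼t) ds dt p =
        Poset.trans (A B _ p) (interpret-mono s≼u ds du p) (interpret-mono u≼t du dt p)
      interpret-mono (axiom a m p' ι dι mι {s = s} {u} c) ds du p =
        let open PosetReasoning (A B _ p)
            ι' = interpret-assignment (ctx (ax T a)) m _ ι dι mι
            (ds' , du' , s≤u) = consequence-holds B (ctx (ax T a)) m _ (fun ι') p'
                                  (isModel 𝔹 a m p' ι') c p
            open Eval S B (ctx (ax T a)) m _ (fun ι')
        in begin
          interpret (instantiate s ι) p ds ≈⟨ eval≈interpret-instantiate _ m _ ι dι s p ds' ds ⟨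
          eval s p ds'                     ≤⟨ s≤u ⟩
          eval u p du'                     ≈⟨ eval≈interpret-instantiate _ m _ ι dι u p du' du ⟩
          interpret (instantiate u ι) p du ∎

      eval≈interpret-instantiate :
        (Γ : Pos) (m : ℕ) .(q : m ≤∞ n) (ι : Carrier Γ → Tm m) (dι : ∀ x → Def (ι x)) →
        ∀ {k} (t : Term S (Carrier Γ) k) .(r : k + m ≤∞ n)
        (dt : Eval.Defined S B Γ m q (λ x → interpret (ι x) q (dι x)) t r)
        (ds : Def (instantiate t ι)) →
        Poset._≈_ (A B (k + m) r) (Eval.eval S B Γ m q (λ x → interpret (ι x) q (dι x)) t r dt)
                                  (interpret (instantiate t ι) r ds)
      eval≈interpret-instantiate Γ m q ι dι (var x) r _ ds = interpret-irrelevant (ι x) _ (dι x) ds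
      eval≈interpret-instantiate Γ m q ι dι (op σ {k} f) r (dts , _) (op dss _) =
        cast-cong B Γ m q (λ x → interpret (ι x) q (dι x)) (sym (+-assoc (dep S σ) k m)) _ r
          (opA-cong B σ _ _ _ _ (λ i → eval≈interpret-instantiate Γ m q ι dι (f i) _ (dts i) (dss i)))

    extension : Hom S FreeAlgebra B
    extension = record
      { hom      = λ k p (t , d) → interpret t p d
      ; hom-mono = λ k p {x} {y} x≼y → interpret-mono x≼y (proj₂ x) (proj₂ y) p
      ; hom-op   = λ σ k p f mf → Poset.Eq.refl (A B (dep S σ + k) p)
      }

    extension-unique : (g : Hom S FreeAlgebra B) →
                       ((x : Carrier X) → Poset._≈_ (A B 0 (zero≤∞ n)) (hom g 0 _ (var x , var)) (fun h x)) →
                       (k : ℕ) (p : k ≤∞ n) (y : Σ (Tm k) Def) →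
                       Poset._≈_ (A B k p) (hom g k p y) (hom extension k p y)
    extension-unique g g∘η≈h _ p (var x , var) = g∘η≈h x
    extension-unique g g∘η≈h _ p (op σ f refl , op ds mon) =
      Poset.Eq.trans (A B _ p) (hom-op g σ _ p _ mon)
        (opA-cong B σ _ p _ _ (λ i → extension-unique g g∘η≈h _ (drop-d (dep S σ) _ p) (f i , ds i)))

  free : FreeModel T n X
  free = record
    { FX     = record { alg = FreeAlgebra ; isModel = freeIsModel }
    ; η      = record { fun = λ x → var x , var ; mono = var }
    ; extend = λ 𝔹 h → Extension.extension 𝔹 h
                     , (λ x → Poset.Eq.refl (A (alg 𝔹) 0 (zero≤∞ n)))
                     , Extension.extension-unique 𝔹 h
    }

mainTheorem10 : (T : Theory) (n : ℕ∞) (X : Pos) → FreeModel T n X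
mainTheorem10 = FreeConstruction.free
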